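{- In the stratified system, the interpretation satisfies: (Weakening) If $R''\ge R'\ge R$, $R\vdash(A,e)$, and $R'\vdash M\in[\![R\vdash(A,e)]\!]$, then $R''\vdash M\in[\![R\vdash(A,e)]\!]$. (Extension/Restriction) If $R''\ge R'\ge R$ and $R\vdash(A,e)$, then $R''\vdash M\in[\![R\vdash(A,e)]\!]$ iff $R''\vdash M\in[\![R'\vdash(A,e)]\!]$. (Subtyping) If $R\vdash(A,e)\le(A',e')$ then $[\![R\vdash(A,e)]\!]\subseteq[\![R\vdash(A',e')]\!]$. (Strong normalisation) If $R'\vdash M\in[\![R\vdash(A,e)]\!]$ and $R''\ge R'$ then $M,[\![R]\!](R'')\in SN$. (Reduction closure) If $R'\vdash M\in[\![R\vdash(A,e)]\!]$, $R''\ge R'$ and $M,[\![R]\!](R'')\to M',S'$, then $R''\vdash M'\in[\![R\vdash(A,e)]\!]$ and $S'=[\![R]\!](R'')$. (Non-emptiness) If $R\vdash A$ then there is a value $V$ such that for all $R'\ge R$ and all $e\subseteq\mathrm{dom}(R)$, $R'\vdash V\in[\![R\vdash(A,e)]\!]$. (Expansion closure) Suppose $R\vdash(A,e)$, $R'\ge R$, $R';\emptyset\vdash M:(A,e)$ and $M$ is neutral. If for all $R''\ge R'$ and all $M',S'$ with $M,[\![R]\!](R'')\to M',S'$ we have $R''\vdash M'\in[\![R\vdash(A,e)]\!]$ and $S'=[\![R]\!](R'')$, then $R'\vdash M\in[\![R\vdash(A,e)]\!]$.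
   Context: Syntax. Regions $r,s,\ldots$; effects $e$ are finite sets of regions. Types: $A ::= \mathbf{1} \mid \mathrm{Reg}_r A \mid A\xrightarrow{e}A$. Region contexts $R=r_1:A_1,\ldots,r_n:A_n$, $\mathrm{dom}(R)=\{r_1,\ldots,r_n\}$. Terms $M ::= x\mid r\mid *\mid \lambda x.M\mid MM\mid \mathsf{get}(M)\mid\mathsf{set}(M,M)$; values $V::= r\mid *\mid \lambda x.M$; a term is neutral if it is not a $\lambda$-abstraction. A store is a finite collection of bindings $r\Leftarrow v$ with $v$ a set of values ($r\Leftarrow v_1,r\Leftarrow v_2$ identified with $r\Leftarrow v_1\cup v_2$, $r\Leftarrow V$ meaning $r\Leftarrow\{V\}$); $\mathrm{dom}(S)$ is the set of bound regions, $S(r)$ the set of values bound to $r$. Reduction. Evaluation contexts $E ::= [\,]\mid EM\mid VE\mid \mathsf{get}(E)\mid\mathsf{set}(E,M)\mid\mathsf{set}(V,E)$. Rules: $E[(\lambda x.M)V]\to E[[V/x]M]$; $E[\mathsf{get}(r)], r\Leftarrow V\to E[V], r\Leftarrow V$; $E[\mathsf{set}(r,V)]\to E[*], r\Leftarrow V$; if $P\to P'$ then $P,P''\to P',P''$. Stratified well-formedness: $\emptyset\vdash$; if $R\vdash A$, $r\notin\mathrm{dom}(R)$ then $R,r:A\vdash$; if $R\vdash$ then $R\vdash\mathbf 1$; if $R\vdash$, $r:A\in R$ then $R\vdash\mathrm{Reg}_rA$; if $R\vdash A$, $R\vdash B$, $e\subseteq\mathrm{dom}(R)$ then $R\vdash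 A\xrightarrow{e}B$; $R\vdash(A,e)$ iff $R\vdash A$ and $e\subseteq\mathrm{dom}(R)$; $R\vdash\Gamma$ iff $R\vdash$ and $R\vdash A_i$ for each $x_i:A_i\in\Gamma$. Subtyping: if $R\vdash A$ then $R\vdash A\le A$; if $R\vdash A'\le A$, $R\vdash B\le B'$, $e\subseteq e'\subseteq\mathrm{dom}(R)$ then $R\vdash (A\xrightarrow{e}B)\le(A'\xrightarrow{e'}B')$; if $R\vdash A\le A'$, $e\subseteq e'\subseteq\mathrm{dom}(R)$ then $R\vdash(A,e)\le(A',e')$. Typing: if $R\vdash\Gamma$, $x:A\in\Gamma$ then $R;\Gamma\vdash x:(A,\emptyset)$; if $R\vdash\Gamma$, $r:A\in R$ then $R;\Gamma\vdash r:(\mathrm{Reg}_rA,\emptyset)$; if $R\vdash\Gamma$ then $R;\Gamma\vdash *:(\mathbf 1,\emptyset)$; from $R;\Gamma,x:A\vdash M:(B,e)$ infer $R;\Gamma\vdash\lambda x.M:(A\xrightarrow{e}B,\emptyset)$; from $R;\Gamma\vdash M:(A\xrightarrow{e_2}B,e_1)$ and $R;\Gamma\vdash N:(A,e_3)$ infer $R;\Gamma\vdash MN:(B,e_1\cup e_2\cup e_3)$; from $R;\Gamma\vdash M:(\mathrm{Reg}_rA,e)$ infer $R;\Gamma\vdash\mathsf{get}(M):(A,e\cup\{r\})$; from $R;\Gamma\vdash M:(\mathrm{Reg}_rA,e_1)$ and $R;\Gamma\vdash N:(A,e_2)$ infer $R;\Gamma\vdash\mathsf{set}(M,N):(\mathbf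 1,e_1\cup e_2\cup\{r\})$; from $R;\Gamma\vdash M:(A,e)$ and $R\vdash(A,e)\le(A',e')$ infer $R;\Gamma\vdash M:(A',e')$. Interpretation. $SN$ is the set of single-threaded programs $M,S$ all of whose reduction sequences are finite. $(M,S)\Downarrow(N,S')$ means $M,S\to^* N,S'$ and $N,S'$ is irreducible. $R'\ge R$ means $R'\vdash$ and $R'=R,R''$ for some $R''$. For $R=r_1:A_1,\ldots,r_n:A_n$ let $R_{r_i}=r_1:A_1,\ldots,r_{i-1}:A_{i-1}$. Define, by induction on the height of the derivations of $R\vdash$ and $R\vdash(A,e)$: $[\![R]\!]$ is the set of pairs $R'\vdash S$ with $R'\ge R$, $\mathrm{dom}(S)=\mathrm{dom}(R)$ and $S(r_i)=\{V\mid R'\vdash V\in[\![R_{r_i}\vdash(A_i,\emptyset)]\!]\}$ for each $i$; for $R'\ge R$, $[\![R]\!](R')$ denotes the unique such $S$. $[\![R\vdash(A,e)]\!]$ is the set of pairs $R'\vdash M$ such that (1) $R'\ge R$ and $R';\emptyset\vdash M:(A,e)$; (2) for all $R''\ge R'$, $M,[\![R]\!](R'')\in SN$; (3) for all $R''\ge R'$ and all $M',S'$, if $(M,[\![R]\!](R''))\Downarrow(M',S')$ then $S'=[\![R]\!](R'')$ and $\mathcal C(A,R,R'',M')$, where $\mathcal C(A,R,R'',M')$ means: if $A=\mathbf 1$ then $M'=*$; if $A=\mathrm{Reg}_rB$ then $M'=r$; if $A=A_1\xrightarrow{e'}A_2$ then $M'=\lambda x.N$ for some $N$ and for all $R_1\ge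 R''$ and all $V$, $R_1\vdash V\in[\![R\vdash(A_1,\emptyset)]\!]$ implies $R_1\vdash M'V\in[\![R\vdash(A_2,e')]\!]$. -}

module Defs where

open import Data.Nat using (ℕ; zero; suc)
open import Data.Empty using (⊥)
open import Data.List using (List; []; _∷_; _++_)
open import Data.List.Membership.Propositional using (_∈_; _∉_)
open import Data.List.Relation.Binary.Subset.Propositional using (_⊆_)
open import Data.List.Relation.Unary.All using (All)
open import Data.Product using (Σ; _×_; _,_)
open import Data.Sum using (_⊎_)
open import Relation.Binary.PropositionalEquality using (_≡_)
open import Relation.Nullary using (¬_)
open import Relation.Binary.Construct.Closure.ReflexiveTransitive using (Star)
open import Induction.WellFounded using (Acc)
open import Function.Bundles using (_⇔_)

Region : Set
Region = ℕ

-- effects: finite sets of regions, as lists (compared by ⊆ = membership)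
Effect : Set
Effect = List Region

data Ty : Set where
  𝟙      : Ty
  Reg    : Region → Ty → Ty
  _⇒[_]_ : Ty → Effect → Ty → Ty

-- region contexts r₁:A₁,…,rₙ:Aₙ (snoc lists; rightmost = most recent)
data RCtx : Set where
  ε     : RCtx
  _▸_∶_ : RCtx → Region → Ty → RCtx

dom : RCtx → List Region
dom ε           = []
dom (R ▸ r ∶ A) = dom R ++ (r ∷ [])

_⧺_ : RCtx → RCtx → RCtx
R ⧺ ε            = R
R ⧺ (R'' ▸ r ∶ A) = (R ⧺ R'') ▸ r ∶ A

data _∶_∈ᴿ_ (r : Region) (A : Ty) : RCtx → Set where
  here  : ∀ {R} → r ∶ A ∈ᴿ (R ▸ r ∶ A)
  there : ∀ {R s B} → r ∶ A ∈ᴿ R → r ∶ A ∈ᴿ (R ▸ s ∶ B)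

data Tm : Set where
  var : ℕ → Tm
  reg : Region → Tm
  ⋆   : Tm
  lam : Tm → Tm
  app : Tm → Tm → Tm
  get : Tm → Tm
  set : Tm → Tm → Tm

data Value : Tm → Set where
  reg : ∀ {r} → Value (reg r)
  ⋆   : Value ⋆
  lam : ∀ {M} → Value (lam M)

Neutral : Tm → Set
Neutral M = ∀ N → ¬ (M ≡ lam N)

mutual
  data ⊢ctx_ : RCtx → Set where
    wf-ε   : ⊢ctx ε
    wf-ext : ∀ {R r A} → R ⊢ty A → r ∉ dom R → ⊢ctx (R ▸ r ∶ A)

  data _⊢ty_ (R : RCtx) : Ty → Set where
    wf-𝟙   : ⊢ctx R → R ⊢ty 𝟙
    wf-reg : ∀ {r A} → ⊢ctx R → r ∶ A ∈ᴿ R → R ⊢ty Reg r A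
    wf-arr : ∀ {A B e} → R ⊢ty A → R ⊢ty B → e ⊆ dom R → R ⊢ty (A ⇒[ e ] B)

WfTE : RCtx → Ty → Effect → Set
WfTE R A e = R ⊢ty A × e ⊆ dom R

_≥_ : RCtx → RCtx → Set
R' ≥ R = ⊢ctx R' × Σ RCtx (λ R'' → R' ≡ R ⧺ R'')

-- typing contexts Γ (index 0 = last bound variable)
data _∋_∶_ : List Ty → ℕ → Ty → Set where
  here  : ∀ {Γ A} → (A ∷ Γ) ∋ zero ∶ A
  there : ∀ {Γ A B x} → Γ ∋ x ∶ A → (B ∷ Γ) ∋ suc x ∶ A

WfΓ : RCtx → List Ty → Set
WfΓ R Γ = ⊢ctx R × All (R ⊢ty_) Γ

data _⊢_≤_ (R : RCtx) : Ty → Ty → Set where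
  ≤-refl : ∀ {A} → R ⊢ty A → R ⊢ A ≤ A
  ≤-arr  : ∀ {A A' B B' e e'} → R ⊢ A' ≤ A → R ⊢ B ≤ B' →
           e ⊆ e' → e' ⊆ dom R → R ⊢ (A ⇒[ e ] B) ≤ (A' ⇒[ e' ] B')

SubTE : RCtx → Ty → Effect → Ty → Effect → Set
SubTE R A e A' e' = R ⊢ A ≤ A' × e ⊆ e' × e' ⊆ dom R

data _︔_⊢_∶_,_ (R : RCtx) (Γ : List Ty) : Tm → Ty → Effect → Set where
  t-var  : ∀ {x A} → WfΓ R Γ → Γ ∋ x ∶ A → R ︔ Γ ⊢ var x ∶ A , []
  t-reg  : ∀ {r A} → WfΓ R Γ → r ∶ A ∈ᴿ R → R ︔ Γ ⊢ reg r ∶ Reg r A , []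
  t-unit : WfΓ R Γ → R ︔ Γ ⊢ ⋆ ∶ 𝟙 , []
  t-lam  : ∀ {M A B e} → R ︔ (A ∷ Γ) ⊢ M ∶ B , e →
           R ︔ Γ ⊢ lam M ∶ (A ⇒[ e ] B) , []
  t-app  : ∀ {M N A B e₁ e₂ e₃} → R ︔ Γ ⊢ M ∶ (A ⇒[ e₂ ] B) , e₁ →
           R ︔ Γ ⊢ N ∶ A , e₃ → R ︔ Γ ⊢ app M N ∶ B , (e₁ ++ e₂ ++ e₃)
  t-get  : ∀ {M r A e} → R ︔ Γ ⊢ M ∶ Reg r A , e →
           R ︔ Γ ⊢ get M ∶ A , (e ++ r ∷ [])
  t-set  : ∀ {M N r A e₁ e₂} → R ︔ Γ ⊢ M ∶ Reg r A , e₁ → R ︔ Γ ⊢ N ∶ A , e₂ →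
           R ︔ Γ ⊢ set M N ∶ 𝟙 , (e₁ ++ e₂ ++ r ∷ [])
  t-sub  : ∀ {M A e A' e'} → R ︔ Γ ⊢ M ∶ A , e → SubTE R A e A' e' →
           R ︔ Γ ⊢ M ∶ A' , e'

ext : (ℕ → ℕ) → ℕ → ℕ
ext ρ zero    = zero
ext ρ (suc x) = suc (ρ x)

rename : (ℕ → ℕ) → Tm → Tm
rename ρ (var x)   = var (ρ x)
rename ρ (reg r)   = reg r
rename ρ ⋆         = ⋆
rename ρ (lam M)   = lam (rename (ext ρ) M)
rename ρ (app M N) = app (rename ρ M) (rename ρ N)
rename ρ (get M)   = get (rename ρ M)
rename ρ (set M N) = set (rename ρ M) (rename ρ N)

exts : (ℕ → Tm) → ℕ → Tm
exts σ zero    = var zero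
exts σ (suc x) = rename suc (σ x)

subst : (ℕ → Tm) → Tm → Tm
subst σ (var x)   = σ x
subst σ (reg r)   = reg r
subst σ ⋆         = ⋆
subst σ (lam M)   = lam (subst (exts σ) M)
subst σ (app M N) = app (subst σ M) (subst σ N)
subst σ (get M)   = get (subst σ M)
subst σ (set M N) = set (subst σ M) (subst σ N)

_[_] : Tm → Tm → Tm
M [ V ] = subst σ M
  where
  σ : ℕ → Tm
  σ zero    = V
  σ (suc x) = var x

data ECtx : Set where
  hole : ECtx
  appL : ECtx → Tm → ECtx
  appR : (V : Tm) → Value V → ECtx → ECtx
  getE : ECtx → ECtx
  setL : ECtx → Tm → ECtx
  setR : (V : Tm) → Value V → ECtx → ECtx

plug : ECtx → Tm → Tm
plug hole         M = M
plug (appL E N)   M = app (plug E M) N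
plug (appR V _ E) M = app V (plug E M)
plug (getE E)     M = get (plug E M)
plug (setL E N)   M = set (plug E M) N
plug (setR V _ E) M = set V (plug E M)

-- A store reachable from an initial store P (a predicate giving, for each
-- region r, the set of values bound to r) is represented by P together
-- with the finite list L of bindings r ⇐ V added by 'set' so far; its
-- contents are P ∪ L.

StorePred : Set₁
StorePred = Region → Tm → Set

Bindings : Set
Bindings = List (Region × Tm)

Contents : StorePred → Bindings → Region → Tm → Set
Contents P L r V = P r V ⊎ (r , V) ∈ L

StoreEq : StorePred → Bindings → Set
StoreEq P L = ∀ r V → Contents P L r V ⇔ P r V

Config : Set
Config = Tm × Bindings

data Step (P : StorePred) : Config → Config → Set where
  β     : ∀ {E M V L} → Value V →
          Step P (plug E (app (lam M) V) , L) (plug E (M [ V ]) , L)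
  get-r : ∀ {E r V L} → Contents P L r V →
          Step P (plug E (get (reg r)) , L) (plug E V , L)
  set-r : ∀ {E r V L} → Value V →
          Step P (plug E (set (reg r) V) , L) (plug E ⋆ , (r , V) ∷ L)

SN : StorePred → Config → Set
SN P c = Acc (λ c' c'' → Step P c'' c') c

Eval : StorePred → Config → Config → Set
Eval P c c' = Star (Step P) c c' × (∀ c'' → ¬ Step P c' c'')

mutual
  -- ⟦ R ⟧ (R') : the store S with S(rᵢ) = { V | R' ⊢ V ∈ ⟦ R_{rᵢ} ⊢ (Aᵢ , ∅) ⟧ }
  ⟦_⟧ˢ : RCtx → RCtx → StorePred
  ⟦ ε ⟧ˢ         R' s V = ⊥
  ⟦ R ▸ r ∶ A ⟧ˢ R' s V = (s ≡ r × Value V × Interp R A [] R' V) ⊎ ⟦ R ⟧ˢ R' s V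

  -- Interp R A e R' M  means  R' ⊢ M ∈ ⟦ R ⊢ (A , e) ⟧
  Interp : RCtx → Ty → Effect → RCtx → Tm → Set
  Interp R A e R' M =
    R' ≥ R × (R' ︔ [] ⊢ M ∶ A , e) ×
    (∀ R'' → R'' ≥ R' → SN (⟦ R ⟧ˢ R'') (M , [])) ×
    (∀ R'' → R'' ≥ R' → ∀ M' L → Eval (⟦ R ⟧ˢ R'') (M , []) (M' , L) →
       StoreEq (⟦ R ⟧ˢ R'') L × Cond A R R'' M')

  Cond : Ty → RCtx → RCtx → Tm → Set
  Cond 𝟙 R R'' M' = M' ≡ ⋆
  Cond (Reg r B) R R'' M' = M' ≡ reg r
  Cond (A₁ ⇒[ e' ] A₂) R R'' M' =
    Σ Tm (λ N → M' ≡ lam N) ×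
    (∀ R₁ → R₁ ≥ R'' → ∀ V → Value V → Interp R A₁ [] R₁ V →
       Interp R A₂ e' R₁ (app M' V))

Weakening : Set
Weakening = ∀ R R' R'' A e M → R'' ≥ R' → R' ≥ R → WfTE R A e →
  Interp R A e R' M → Interp R A e R'' M

ExtensionRestriction : Set
ExtensionRestriction = ∀ R R' R'' A e M → R'' ≥ R' → R' ≥ R → WfTE R A e →
  Interp R A e R'' M ⇔ Interp R' A e R'' M

SubtypingProp : Set
SubtypingProp = ∀ R A e A' e' → SubTE R A e A' e' →
  ∀ R' M → Interp R A e R' M → Interp R A' e' R' M

StrongNormalisation : Set
StrongNormalisation = ∀ R A e R' R'' M → Interp R A e R' M → R'' ≥ R' →
  SN (⟦ R ⟧ˢ R'') (M , [])

ReductionClosure : Set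
ReductionClosure = ∀ R A e R' R'' M M' L → Interp R A e R' M → R'' ≥ R' →
  Step (⟦ R ⟧ˢ R'') (M , []) (M' , L) →
  Interp R A e R'' M' × StoreEq (⟦ R ⟧ˢ R'') L

NonEmptiness : Set
NonEmptiness = ∀ R A → R ⊢ty A →
  Σ Tm (λ V → Value V × (∀ R' → R' ≥ R → ∀ e → e ⊆ dom R → Interp R A e R' V))

ExpansionClosure : Set
ExpansionClosure = ∀ R A e R' M → WfTE R A e → R' ≥ R →
  R' ︔ [] ⊢ M ∶ A , e → Neutral M →
  (∀ R'' → R'' ≥ R' → ∀ M' L → Step (⟦ R ⟧ˢ R'') (M , []) (M' , L) →
     Interp R A e R'' M' × StoreEq (⟦ R ⟧ˢ R'') L) →
  Interp R A e R' M

module Submission where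

-- On the semantic side: ⟦ R ⟧(R') grows with R'; the expansion lemma says
-- a program all of whose reducts are interpreted is itself interpreted;
-- every well-formed type has a canonical inhabitant, so the stores
-- ⟦ R ⟧(R') are inhabited on dom R and their lookups are decidable, which
-- lets strongly normalising programs be run to a normal form.

open import Defs
open import Data.Nat using (ℕ; suc) renaming (_≟_ to _≟ℕ_)
open import Data.Empty using (⊥-elim)
open import Data.List using (List; []; _∷_; _++_)
open import Data.List.Properties using (++-identityʳ)
open import Data.List.Membership.Propositional using (_∈_)
open import Data.List.Membership.Propositional.Properties using (∈-++⁺ˡ; ∈-++⁺ʳ; ∈-++⁻)
open import Data.List.Membership.DecPropositional _≟ℕ_ using (_∈?_)
open import Data.List.Relation.Binary.Subset.Propositional using (_⊆_)
open import Data.List.Relation.Binary.Subset.Propositional.Properties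
  using (⊆-refl; ⊆-trans; ⊆-reflexive)
open import Data.List.Relation.Unary.All using (All; []; _∷_)
import Data.List.Relation.Unary.All as All
open import Data.List.Relation.Unary.Any using (here; there)
open import Data.Product using (Σ; _×_; _,_; proj₁; proj₂)
open import Data.Sum using (_⊎_; inj₁; inj₂; [_,_]′)
open import Relation.Binary.PropositionalEquality using (_≡_; refl; sym; trans; cong; cong₂)
import Relation.Binary.PropositionalEquality as Eq
open import Relation.Nullary using (¬_; yes; no)
open import Relation.Binary.Construct.Closure.ReflexiveTransitive using (Star; _◅_)
  renaming (ε to done)
open import Induction.WellFounded using (acc)
open import Function.Base using (id)
open import Function.Bundles using (_⇔_; mk⇔; Equivalence)

-- Region contexts and their extensions.

⧺-assoc : ∀ R X Y → (R ⧺ X) ⧺ Y ≡ R ⧺ (X ⧺ Y)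
⧺-assoc R X ε           = refl
⧺-assoc R X (Y ▸ r ∶ A) = cong (_▸ r ∶ A) (⧺-assoc R X Y)

wfTy⇒wfCtx : ∀ {R A} → R ⊢ty A → ⊢ctx R
wfTy⇒wfCtx (wf-𝟙 ⊢R)       = ⊢R
wfTy⇒wfCtx (wf-reg ⊢R _)   = ⊢R
wfTy⇒wfCtx (wf-arr ⊢A _ _) = wfTy⇒wfCtx ⊢A

wfCtx-prefix : ∀ R X → ⊢ctx (R ⧺ X) → ⊢ctx R
wfCtx-prefix R ε           ⊢R            = ⊢R
wfCtx-prefix R (X ▸ _ ∶ _) (wf-ext ⊢A _) = wfCtx-prefix R X (wfTy⇒wfCtx ⊢A)

∈ᴿ-⧺ : ∀ {r A R} X → r ∶ A ∈ᴿ R → r ∶ A ∈ᴿ (R ⧺ X)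
∈ᴿ-⧺ ε           p = p
∈ᴿ-⧺ (X ▸ _ ∶ _) p = there (∈ᴿ-⧺ X p)

dom-⧺ : ∀ {R} X → dom R ⊆ dom (R ⧺ X)
dom-⧺ ε           m = m
dom-⧺ (X ▸ _ ∶ _) m = ∈-++⁺ˡ (dom-⧺ X m)

wfTy-⧺ : ∀ {R A} X → R ⊢ty A → ⊢ctx (R ⧺ X) → (R ⧺ X) ⊢ty A
wfTy-⧺ X (wf-𝟙 _)          ⊢RX = wf-𝟙 ⊢RX
wfTy-⧺ X (wf-reg _ p)      ⊢RX = wf-reg ⊢RX (∈ᴿ-⧺ X p)
wfTy-⧺ X (wf-arr ⊢A ⊢B e⊆) ⊢RX =
  wf-arr (wfTy-⧺ X ⊢A ⊢RX) (wfTy-⧺ X ⊢B ⊢RX) (⊆-trans e⊆ (dom-⧺ X))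

∈ᴿ⇒dom : ∀ {r A R} → r ∶ A ∈ᴿ R → r ∈ dom R
∈ᴿ⇒dom here      = ∈-++⁺ʳ _ (here refl)
∈ᴿ⇒dom (there p) = ∈-++⁺ˡ (∈ᴿ⇒dom p)

∈ᴿ-unique : ∀ {r A B R} → ⊢ctx R → r ∶ A ∈ᴿ R → r ∶ B ∈ᴿ R → A ≡ B
∈ᴿ-unique _              here      here      = refl
∈ᴿ-unique (wf-ext _ r∉)  here      (there q) = ⊥-elim (r∉ (∈ᴿ⇒dom q))
∈ᴿ-unique (wf-ext _ r∉)  (there p) here      = ⊥-elim (r∉ (∈ᴿ⇒dom p))
∈ᴿ-unique (wf-ext ⊢A _)  (there p) (there q) = ∈ᴿ-unique (wfTy⇒wfCtx ⊢A) p q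

∈ᴿ-wfTy : ∀ {r A R} → ⊢ctx R → r ∶ A ∈ᴿ R → R ⊢ty A
∈ᴿ-wfTy ⊢R@(wf-ext ⊢A _) here      = wfTy-⧺ (ε ▸ _ ∶ _) ⊢A ⊢R
∈ᴿ-wfTy ⊢R@(wf-ext ⊢A _) (there p) = wfTy-⧺ (ε ▸ _ ∶ _) (∈ᴿ-wfTy (wfTy⇒wfCtx ⊢A) p) ⊢R

≥-refl : ∀ {R} → ⊢ctx R → R ≥ R
≥-refl ⊢R = ⊢R , ε , refl

≥-trans : ∀ {R R' R''} → R'' ≥ R' → R' ≥ R → R'' ≥ R
≥-trans {R} (⊢R'' , Y , refl) (_ , X , refl) = ⊢R'' , X ⧺ Y , ⧺-assoc R X Y

≥⇒wfCtx : ∀ {R R'} → R' ≥ R → ⊢ctx R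
≥⇒wfCtx {R} (⊢R' , X , refl) = wfCtx-prefix R X ⊢R'

≥-unsnoc : ∀ {R s A R''} → R'' ≥ (R ▸ s ∶ A) → R'' ≥ R
≥-unsnoc {R} {s} {A} (⊢R'' , X , eq) = ⊢R'' , (ε ▸ s ∶ A) ⧺ X , trans eq (⧺-assoc R (ε ▸ s ∶ A) X)

∈ᴿ-≥ : ∀ {R R' r A} → R' ≥ R → r ∶ A ∈ᴿ R → r ∶ A ∈ᴿ R'
∈ᴿ-≥ (_ , X , refl) = ∈ᴿ-⧺ X

dom-≥ : ∀ {R R'} → R' ≥ R → dom R ⊆ dom R'
dom-≥ (_ , X , refl) = dom-⧺ X

wfTy-≥ : ∀ {R R' A} → R' ≥ R → R ⊢ty A → R' ⊢ty A
wfTy-≥ (⊢R' , X , refl) ⊢A = wfTy-⧺ X ⊢A ⊢R'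

≤-wfTy : ∀ {R A B} → R ⊢ A ≤ B → R ⊢ty A × R ⊢ty B
≤-wfTy (≤-refl ⊢A) = ⊢A , ⊢A
≤-wfTy (≤-arr A'≤A B≤B' e⊆e' e'⊆) =
  wf-arr (proj₂ (≤-wfTy A'≤A)) (proj₁ (≤-wfTy B≤B')) (⊆-trans e⊆e' e'⊆) ,
  wf-arr (proj₁ (≤-wfTy A'≤A)) (proj₂ (≤-wfTy B≤B')) e'⊆

≤-trans : ∀ {R A B C} → R ⊢ A ≤ B → R ⊢ B ≤ C → R ⊢ A ≤ C
≤-trans (≤-refl _)           B≤C                    = B≤C
≤-trans A≤B@(≤-arr _ _ _ _)  (≤-refl _)             = A≤B
≤-trans (≤-arr p₁ q₁ s₁ _)   (≤-arr p₂ q₂ s₂ s₂') =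
  ≤-arr (≤-trans p₂ p₁) (≤-trans q₁ q₂) (⊆-trans s₁ s₂) s₂'

≤-⧺ : ∀ {R A B} X → R ⊢ A ≤ B → ⊢ctx (R ⧺ X) → (R ⧺ X) ⊢ A ≤ B
≤-⧺ X (≤-refl ⊢A)       ⊢RX = ≤-refl (wfTy-⧺ X ⊢A ⊢RX)
≤-⧺ X (≤-arr p q s s') ⊢RX = ≤-arr (≤-⧺ X p ⊢RX) (≤-⧺ X q ⊢RX) s (⊆-trans s' (dom-⧺ X))

≤-≥ : ∀ {R R' A B} → R' ≥ R → R ⊢ A ≤ B → R' ⊢ A ≤ B
≤-≥ (⊢R' , X , refl) A≤B = ≤-⧺ X A≤B ⊢R'

++-⊆ : ∀ {xs ys zs : List Region} → xs ⊆ zs → ys ⊆ zs → xs ++ ys ⊆ zs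
++-⊆ {xs} xs⊆ ys⊆ m = [ xs⊆ , ys⊆ ]′ (∈-++⁻ xs m)

typing⇒wfΓ : ∀ {R Γ M A e} → R ︔ Γ ⊢ M ∶ A , e → WfΓ R Γ
typing⇒wfΓ (t-var w _)   = w
typing⇒wfΓ (t-reg w _)   = w
typing⇒wfΓ (t-unit w)    = w
typing⇒wfΓ (t-lam ⊢M) with typing⇒wfΓ ⊢M
... | ⊢R , _ ∷ ⊢Γ        = ⊢R , ⊢Γ
typing⇒wfΓ (t-app ⊢M _)  = typing⇒wfΓ ⊢M
typing⇒wfΓ (t-get ⊢M)    = typing⇒wfΓ ⊢M
typing⇒wfΓ (t-set ⊢M _)  = typing⇒wfΓ ⊢M
typing⇒wfΓ (t-sub ⊢M _)  = typing⇒wfΓ ⊢M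

∋-wfTy : ∀ {R Γ x A} → All (R ⊢ty_) Γ → Γ ∋ x ∶ A → R ⊢ty A
∋-wfTy (⊢A ∷ _)  here      = ⊢A
∋-wfTy (_ ∷ ⊢Γ)  (there p) = ∋-wfTy ⊢Γ p

regular : ∀ {R Γ M A e} → R ︔ Γ ⊢ M ∶ A , e → R ⊢ty A × e ⊆ dom R
regular (t-var (_ , ⊢Γ) p) = ∋-wfTy ⊢Γ p , λ ()
regular (t-reg (⊢R , _) p) = wf-reg ⊢R p , λ ()
regular (t-unit (⊢R , _))  = wf-𝟙 ⊢R , λ ()
regular (t-lam ⊢M) with typing⇒wfΓ ⊢M | regular ⊢M
... | _ , ⊢A ∷ _ | ⊢B , e⊆ = wf-arr ⊢A ⊢B e⊆ , λ ()
regular (t-app ⊢M ⊢N) with regular ⊢M | regular ⊢N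
... | wf-arr _ ⊢B e₂⊆ , e₁⊆ | _ , e₃⊆ = ⊢B , ++-⊆ e₁⊆ (++-⊆ e₂⊆ e₃⊆)
regular (t-get ⊢M) with regular ⊢M
... | wf-reg ⊢R p , e⊆ = ∈ᴿ-wfTy ⊢R p , ++-⊆ e⊆ (λ { (here refl) → ∈ᴿ⇒dom p })
regular (t-set ⊢M ⊢N) with regular ⊢M | regular ⊢N
... | wf-reg ⊢R p , e₁⊆ | _ , e₂⊆ = wf-𝟙 ⊢R , ++-⊆ e₁⊆ (++-⊆ e₂⊆ (λ { (here refl) → ∈ᴿ⇒dom p }))
regular (t-sub _ (A≤A' , _ , e'⊆)) = proj₂ (≤-wfTy A≤A') , e'⊆

wfΓ-⧺ : ∀ {R Γ} X → WfΓ R Γ → ⊢ctx (R ⧺ X) → WfΓ (R ⧺ X) Γ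
wfΓ-⧺ X (_ , ⊢Γ) ⊢RX = ⊢RX , All.map (λ ⊢A → wfTy-⧺ X ⊢A ⊢RX) ⊢Γ

typing-⧺ : ∀ {R Γ M A e} X → R ︔ Γ ⊢ M ∶ A , e → ⊢ctx (R ⧺ X) → (R ⧺ X) ︔ Γ ⊢ M ∶ A , e
typing-⧺ X (t-var w p)     ⊢RX = t-var (wfΓ-⧺ X w ⊢RX) p
typing-⧺ X (t-reg w p)     ⊢RX = t-reg (wfΓ-⧺ X w ⊢RX) (∈ᴿ-⧺ X p)
typing-⧺ X (t-unit w)      ⊢RX = t-unit (wfΓ-⧺ X w ⊢RX)
typing-⧺ X (t-lam ⊢M)      ⊢RX = t-lam (typing-⧺ X ⊢M ⊢RX)
typing-⧺ X (t-app ⊢M ⊢N)   ⊢RX = t-app (typing-⧺ X ⊢M ⊢RX) (typing-⧺ X ⊢N ⊢RX)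
typing-⧺ X (t-get ⊢M)      ⊢RX = t-get (typing-⧺ X ⊢M ⊢RX)
typing-⧺ X (t-set ⊢M ⊢N)   ⊢RX = t-set (typing-⧺ X ⊢M ⊢RX) (typing-⧺ X ⊢N ⊢RX)
typing-⧺ X (t-sub ⊢M (A≤A' , e⊆e' , e'⊆)) ⊢RX =
  t-sub (typing-⧺ X ⊢M ⊢RX) (≤-⧺ X A≤A' ⊢RX , e⊆e' , ⊆-trans e'⊆ (dom-⧺ X))

typing-≥ : ∀ {R R' Γ M A e} → R' ≥ R → R ︔ Γ ⊢ M ∶ A , e → R' ︔ Γ ⊢ M ∶ A , e
typing-≥ (⊢R' , X , refl) ⊢M = typing-⧺ X ⊢M ⊢R'

rename-typing : ∀ {R Γ Δ M A e} (ρ : ℕ → ℕ) → (∀ {x B} → Γ ∋ x ∶ B → Δ ∋ ρ x ∶ B) →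
  WfΓ R Δ → R ︔ Γ ⊢ M ∶ A , e → R ︔ Δ ⊢ rename ρ M ∶ A , e
rename-typing ρ ρ⊢ w (t-var _ p)   = t-var w (ρ⊢ p)
rename-typing ρ ρ⊢ w (t-reg _ p)   = t-reg w p
rename-typing ρ ρ⊢ w (t-unit _)    = t-unit w
rename-typing ρ ρ⊢ w (t-lam ⊢M) with typing⇒wfΓ ⊢M
... | _ , ⊢A ∷ _ = t-lam (rename-typing (ext ρ) ext⊢ (proj₁ w , ⊢A ∷ proj₂ w) ⊢M)
  where
  ext⊢ : ∀ {x B} → _ ∋ x ∶ B → _ ∋ ext ρ x ∶ B
  ext⊢ here      = here
  ext⊢ (there p) = there (ρ⊢ p)
rename-typing ρ ρ⊢ w (t-app ⊢M ⊢N) = t-app (rename-typing ρ ρ⊢ w ⊢M) (rename-typing ρ ρ⊢ w ⊢N)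
rename-typing ρ ρ⊢ w (t-get ⊢M)    = t-get (rename-typing ρ ρ⊢ w ⊢M)
rename-typing ρ ρ⊢ w (t-set ⊢M ⊢N) = t-set (rename-typing ρ ρ⊢ w ⊢M) (rename-typing ρ ρ⊢ w ⊢N)
rename-typing ρ ρ⊢ w (t-sub ⊢M s)  = t-sub (rename-typing ρ ρ⊢ w ⊢M) s

subst-typing : ∀ {R Γ Δ M A e} (σ : ℕ → Tm) → (∀ {x B} → Γ ∋ x ∶ B → R ︔ Δ ⊢ σ x ∶ B , []) →
  WfΓ R Δ → R ︔ Γ ⊢ M ∶ A , e → R ︔ Δ ⊢ subst σ M ∶ A , e
subst-typing σ σ⊢ w (t-var _ p)   = σ⊢ p
subst-typing σ σ⊢ w (t-reg _ p)   = t-reg w p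
subst-typing σ σ⊢ w (t-unit _)    = t-unit w
subst-typing {R} σ σ⊢ w (t-lam ⊢M) with typing⇒wfΓ ⊢M
... | _ , ⊢A ∷ _ = t-lam (subst-typing (exts σ) exts⊢ (proj₁ w , ⊢A ∷ proj₂ w) ⊢M)
  where
  exts⊢ : ∀ {x B} → _ ∋ x ∶ B → R ︔ _ ⊢ exts σ x ∶ B , []
  exts⊢ here      = t-var (proj₁ w , ⊢A ∷ proj₂ w) here
  exts⊢ (there p) = rename-typing suc there (proj₁ w , ⊢A ∷ proj₂ w) (σ⊢ p)
subst-typing σ σ⊢ w (t-app ⊢M ⊢N) = t-app (subst-typing σ σ⊢ w ⊢M) (subst-typing σ σ⊢ w ⊢N)
subst-typing σ σ⊢ w (t-get ⊢M)    = t-get (subst-typing σ σ⊢ w ⊢M)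
subst-typing σ σ⊢ w (t-set ⊢M ⊢N) = t-set (subst-typing σ σ⊢ w ⊢M) (subst-typing σ σ⊢ w ⊢N)
subst-typing σ σ⊢ w (t-sub ⊢M s)  = t-sub (subst-typing σ σ⊢ w ⊢M) s

value-pure : ∀ {R Γ V A e} → Value V → R ︔ Γ ⊢ V ∶ A , e → R ︔ Γ ⊢ V ∶ A , []
value-pure reg (t-reg w p)               = t-reg w p
value-pure ⋆   (t-unit w)                = t-unit w
value-pure lam (t-lam ⊢M)                = t-lam ⊢M
value-pure v   (t-sub ⊢V (A≤A' , _ , _)) = t-sub (value-pure v ⊢V) (A≤A' , (λ ()) , λ ())

Shape : Ty → Tm → Set
Shape 𝟙            M = M ≡ ⋆
Shape (Reg r B)    M = M ≡ reg r
Shape (A ⇒[ e ] B) M = Σ Tm λ N → M ≡ lam N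

-- Subtyping preserves shapes: it only relates arrow types to arrow types.
shape-≤ : ∀ {R A A' M} → R ⊢ A ≤ A' → Shape A M → Shape A' M
shape-≤ (≤-refl _)       s = s
shape-≤ (≤-arr _ _ _ _) s = s

canonical : ∀ {R Γ V A e} → Value V → R ︔ Γ ⊢ V ∶ A , e → Shape A V
canonical reg (t-reg _ _)        = refl
canonical ⋆   (t-unit _)         = refl
canonical lam (t-lam _)          = _ , refl
canonical v   (t-sub ⊢V (A≤A' , _)) = shape-≤ A≤A' (canonical v ⊢V)

reg-inversion : ∀ {R Γ r A e} → R ︔ Γ ⊢ reg r ∶ A , e → Σ Ty λ B → A ≡ Reg r B × r ∶ B ∈ᴿ R
reg-inversion (t-reg _ p) = _ , refl , p
reg-inversion (t-sub ⊢r (A≤A' , _)) with reg-inversion ⊢r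
... | B , refl , p with A≤A'
...   | ≤-refl _ = B , refl , p

lam-inversion : ∀ {R Γ M A B e₁ e₂} → R ︔ Γ ⊢ lam M ∶ (A ⇒[ e₂ ] B) , e₁ →
  Σ Ty λ A₀ → Σ Ty λ B₀ → Σ Effect λ e₀ →
    R ︔ (A₀ ∷ Γ) ⊢ M ∶ B₀ , e₀ × R ⊢ A ≤ A₀ × R ⊢ B₀ ≤ B × e₀ ⊆ e₂
lam-inversion (t-lam ⊢M) with typing⇒wfΓ ⊢M | regular ⊢M
... | _ , ⊢A ∷ _ | ⊢B , _ = _ , _ , _ , ⊢M , ≤-refl ⊢A , ≤-refl ⊢B , ⊆-refl
lam-inversion (t-sub ⊢λ (≤-refl _ , _)) = lam-inversion ⊢λ
lam-inversion (t-sub ⊢λ (≤-arr A'≤A B≤B' e⊆e' _ , _)) with lam-inversion ⊢λ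
... | A₀ , B₀ , e₀ , ⊢M , A≤A₀ , B₀≤B , e₀⊆ =
  A₀ , B₀ , e₀ , ⊢M , ≤-trans A'≤A A≤A₀ , ≤-trans B₀≤B B≤B' , ⊆-trans e₀⊆ e⊆e'

β-typing : ∀ {R N V B e} → Value V → R ︔ [] ⊢ app (lam N) V ∶ B , e → R ︔ [] ⊢ N [ V ] ∶ B , e
β-typing v ⊢app@(t-app {e₁ = e₁} ⊢λ ⊢V) with lam-inversion ⊢λ | regular ⊢app
... | A₀ , B₀ , e₀ , ⊢N , A≤A₀ , B₀≤B , e₀⊆ | _ , e⊆ =
  t-sub (subst-typing _ V⊢ (typing⇒wfΓ ⊢V) ⊢N) (B₀≤B , (λ m → ∈-++⁺ʳ e₁ (∈-++⁺ˡ (e₀⊆ m))) , e⊆)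
  where
  V⊢ : ∀ {x B'} → (A₀ ∷ []) ∋ x ∶ B' → _ ︔ [] ⊢ _ ∶ B' , []
  V⊢ here = t-sub (value-pure v ⊢V) (A≤A₀ , (λ ()) , λ ())
β-typing v (t-sub ⊢app s) = t-sub (β-typing v ⊢app) s

record PlugTyping (R : RCtx) (E : ECtx) (N : Tm) (A : Ty) (e : Effect) : Set where
  constructor plug-typed
  field
    holeTy   : Ty
    holeEff  : Effect
    hole⊢    : R ︔ [] ⊢ N ∶ holeTy , holeEff
    holeEff⊆ : holeEff ⊆ e
    refill   : ∀ {N'} → R ︔ [] ⊢ N' ∶ holeTy , holeEff → R ︔ [] ⊢ plug E N' ∶ A , e

plug-typing : ∀ {R N A e} E → R ︔ [] ⊢ plug E N ∶ A , e → PlugTyping R E N A e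
plug-typing hole ⊢N = plug-typed _ _ ⊢N ⊆-refl λ ⊢N' → ⊢N'
plug-typing E (t-sub ⊢EN s) with plug-typing E ⊢EN
... | plug-typed B eN ⊢N eN⊆ refill =
  plug-typed B eN ⊢N (⊆-trans eN⊆ (proj₁ (proj₂ s))) λ ⊢N' → t-sub (refill ⊢N') s
plug-typing (appL E N₂) (t-app ⊢EN ⊢N₂) with plug-typing E ⊢EN
... | plug-typed B eN ⊢N eN⊆ refill =
  plug-typed B eN ⊢N (λ m → ∈-++⁺ˡ (eN⊆ m)) λ ⊢N' → t-app (refill ⊢N') ⊢N₂
plug-typing (appR V _ E) (t-app {e₁ = e₁} {e₂ = e₂} ⊢V ⊢EN) with plug-typing E ⊢EN
... | plug-typed B eN ⊢N eN⊆ refill =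
  plug-typed B eN ⊢N (λ m → ∈-++⁺ʳ e₁ (∈-++⁺ʳ e₂ (eN⊆ m))) λ ⊢N' → t-app ⊢V (refill ⊢N')
plug-typing (getE E) (t-get ⊢EN) with plug-typing E ⊢EN
... | plug-typed B eN ⊢N eN⊆ refill =
  plug-typed B eN ⊢N (λ m → ∈-++⁺ˡ (eN⊆ m)) λ ⊢N' → t-get (refill ⊢N')
plug-typing (setL E N₂) (t-set ⊢EN ⊢N₂) with plug-typing E ⊢EN
... | plug-typed B eN ⊢N eN⊆ refill =
  plug-typed B eN ⊢N (λ m → ∈-++⁺ˡ (eN⊆ m)) λ ⊢N' → t-set (refill ⊢N') ⊢N₂
plug-typing (setR V _ E) (t-set {e₁ = e₁} ⊢V ⊢EN) with plug-typing E ⊢EN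
... | plug-typed B eN ⊢N eN⊆ refill =
  plug-typed B eN ⊢N (λ m → ∈-++⁺ʳ e₁ (∈-++⁺ˡ (eN⊆ m))) λ ⊢N' → t-set ⊢V (refill ⊢N')

get-inversion : ∀ {R r B e} → R ︔ [] ⊢ get (reg r) ∶ B , e →
  Σ Ty λ B₀ → r ∶ B₀ ∈ᴿ R × R ⊢ B₀ ≤ B × r ∈ e
get-inversion (t-get {e = e₀} ⊢r) with reg-inversion ⊢r | typing⇒wfΓ ⊢r
... | B , refl , p | ⊢R , _ = B , p , ≤-refl (∈ᴿ-wfTy ⊢R p) , ∈-++⁺ʳ e₀ (here refl)
get-inversion (t-sub ⊢get (B≤B' , e⊆e' , _)) with get-inversion ⊢get
... | B₀ , p , B₀≤B , r∈e = B₀ , p , ≤-trans B₀≤B B≤B' , e⊆e' r∈e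

read-in-effect : ∀ {R r A e} E → R ︔ [] ⊢ plug E (get (reg r)) ∶ A , e → r ∈ e
read-in-effect E ⊢M with plug-typing E ⊢M
... | plug-typed _ _ ⊢get eN⊆ _ = eN⊆ (proj₂ (proj₂ (proj₂ (get-inversion ⊢get))))

set-inversion : ∀ {R r V B e} → R ︔ [] ⊢ set (reg r) V ∶ B , e →
  Σ Ty λ A₀ → Σ Effect λ e₂ → r ∶ A₀ ∈ᴿ R × R ︔ [] ⊢ V ∶ A₀ , e₂ × r ∈ e × R ︔ [] ⊢ ⋆ ∶ B , e
set-inversion ⊢set@(t-set {e₁ = e₁} {e₂ = e₂} ⊢r ⊢V) with reg-inversion ⊢r | typing⇒wfΓ ⊢r | regular ⊢set
... | A , refl , p | w | _ , e⊆ =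
  A , _ , p , ⊢V , ∈-++⁺ʳ e₁ (∈-++⁺ʳ e₂ (here refl)) ,
  t-sub (t-unit w) (≤-refl (wf-𝟙 (proj₁ w)) , (λ ()) , e⊆)
set-inversion (t-sub ⊢set s) with set-inversion ⊢set
... | A₀ , e₂ , p , ⊢V , r∈e , ⊢⋆ = A₀ , e₂ , p , ⊢V , proj₁ (proj₂ s) r∈e , t-sub ⊢⋆ s

-- Subject reduction.

TypedStore : RCtx → StorePred → Set
TypedStore R P = ∀ r V → P r V → ∀ B → r ∶ B ∈ᴿ R → R ︔ [] ⊢ V ∶ B , []

TypedBindings : RCtx → Bindings → Set
TypedBindings R L = TypedStore R (λ r V → (r , V) ∈ L)

subject-reduction : ∀ {R P M L M' L' A e} → ⊢ctx R → TypedStore R P → Step P (M , L) (M' , L') →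
  R ︔ [] ⊢ M ∶ A , e → TypedBindings R L →
  R ︔ [] ⊢ M' ∶ A , e × TypedBindings R L' × (∀ r V → (r , V) ∈ L' → (r , V) ∈ L ⊎ r ∈ e)
subject-reduction _ _ (β {E} v) ⊢M ⊢L with plug-typing E ⊢M
... | plug-typed _ _ ⊢redex _ refill = refill (β-typing v ⊢redex) , ⊢L , λ _ _ → inj₁
subject-reduction {R} {P} _ ⊢P (get-r {E} {r} {V} {L} found) ⊢M ⊢L with plug-typing E ⊢M
... | plug-typed _ _ ⊢get _ refill with get-inversion ⊢get | regular ⊢get
...   | B₀ , p , B₀≤B , _ | _ , e⊆ = refill (t-sub (⊢found found) (B₀≤B , (λ ()) , e⊆)) , ⊢L , λ _ _ → inj₁
  where
  ⊢found : Contents P L r V → R ︔ [] ⊢ V ∶ B₀ , []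
  ⊢found (inj₁ inP) = ⊢P r V inP B₀ p
  ⊢found (inj₂ inL) = ⊢L r V inL B₀ p
subject-reduction {R} ⊢R _ (set-r {E} {r} {V} {L} v) ⊢M ⊢L with plug-typing E ⊢M
... | plug-typed _ _ ⊢set eN⊆ refill with set-inversion ⊢set
...   | _ , _ , p , ⊢V , r∈e , ⊢⋆ = refill ⊢⋆ , ⊢L' , new
  where
  ⊢L' : TypedBindings R ((r , V) ∷ L)
  ⊢L' _ _ (here refl) B q = Eq.subst (λ T → R ︔ [] ⊢ V ∶ T , []) (∈ᴿ-unique ⊢R p q) (value-pure v ⊢V)
  ⊢L' r' V' (there m) B q = ⊢L r' V' m B q
  new : ∀ r' V' → (r' , V') ∈ (r , V) ∷ L → (r' , V') ∈ L ⊎ r' ∈ _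
  new _ _ (here refl) = inj₂ (eN⊆ r∈e)
  new _ _ (there m)   = inj₁ m

-- Unique decomposition and progress.

data Redex : Tm → Set where
  β-redex   : ∀ {M V} → Value V → Redex (app (lam M) V)
  get-redex : ∀ {r} → Redex (get (reg r))
  set-redex : ∀ {r V} → Value V → Redex (set (reg r) V)

plug-redex-not-value : ∀ E {ρ} → Redex ρ → ¬ Value (plug E ρ)
plug-redex-not-value hole         (β-redex _)   ()
plug-redex-not-value hole         get-redex     ()
plug-redex-not-value hole         (set-redex _) ()
plug-redex-not-value (appL _ _)   _ ()
plug-redex-not-value (appR _ _ _) _ ()
plug-redex-not-value (getE _)     _ ()
plug-redex-not-value (setL _ _)   _ ()
plug-redex-not-value (setR _ _ _) _ ()

-- The first and second immediate subterms, used to invert equations between plugged programs.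
sub₁ : Tm → Tm
sub₁ (app M _) = M
sub₁ (get M)   = M
sub₁ (set M _) = M
sub₁ M         = M

sub₂ : Tm → Tm
sub₂ (app _ N) = N
sub₂ (set _ N) = N
sub₂ M         = M

plug-unique-hole : ∀ E' {ρ ρ'} → Redex ρ → Redex ρ' → ρ ≡ plug E' ρ' →
  ρ ≡ ρ' × (∀ N → N ≡ plug E' N)
plug-unique-hole hole _ _ eq = eq , λ _ → refl
plug-unique-hole (appL F _)   (β-redex _)   r' eq = ⊥-elim (plug-redex-not-value F r' (Eq.subst Value (cong sub₁ eq) lam))
plug-unique-hole (appR _ _ F) (β-redex v)   r' eq = ⊥-elim (plug-redex-not-value F r' (Eq.subst Value (cong sub₂ eq) v))
plug-unique-hole (getE F)     get-redex     r' eq = ⊥-elim (plug-redex-not-value F r' (Eq.subst Value (cong sub₁ eq) reg))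
plug-unique-hole (setL F _)   (set-redex _) r' eq = ⊥-elim (plug-redex-not-value F r' (Eq.subst Value (cong sub₁ eq) reg))
plug-unique-hole (setR _ _ F) (set-redex v) r' eq = ⊥-elim (plug-redex-not-value F r' (Eq.subst Value (cong sub₂ eq) v))
plug-unique-hole (appL _ _)   get-redex     _ ()
plug-unique-hole (appL _ _)   (set-redex _) _ ()
plug-unique-hole (appR _ _ _) get-redex     _ ()
plug-unique-hole (appR _ _ _) (set-redex _) _ ()
plug-unique-hole (getE _)     (β-redex _)   _ ()
plug-unique-hole (getE _)     (set-redex _) _ ()
plug-unique-hole (setL _ _)   (β-redex _)   _ ()
plug-unique-hole (setL _ _)   get-redex     _ ()
plug-unique-hole (setR _ _ _) (β-redex _)   _ ()
plug-unique-hole (setR _ _ _) get-redex     _ ()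

-- Unique decomposition: a program is E[ρ] for at most one redex ρ and
-- evaluation context E (up to the choice of value proofs in E).
plug-unique : ∀ E E' {ρ ρ'} → Redex ρ → Redex ρ' → plug E ρ ≡ plug E' ρ' →
  ρ ≡ ρ' × (∀ N → plug E N ≡ plug E' N)
plug-unique hole E' r r' eq = plug-unique-hole E' r r' eq
plug-unique E hole r r' eq with plug-unique-hole E r' r (sym eq)
... | ρ'≡ρ , same = sym ρ'≡ρ , λ N → sym (same N)
plug-unique (appL E _) (appL E' _) r r' eq with plug-unique E E' r r' (cong sub₁ eq)
... | ρ≡ρ' , same = ρ≡ρ' , λ N → cong₂ app (same N) (cong sub₂ eq)
plug-unique (appR _ _ E) (appR _ _ E') r r' eq with plug-unique E E' r r' (cong sub₂ eq)
... | ρ≡ρ' , same = ρ≡ρ' , λ N → cong₂ app (cong sub₁ eq) (same N)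
plug-unique (getE E) (getE E') r r' eq with plug-unique E E' r r' (cong sub₁ eq)
... | ρ≡ρ' , same = ρ≡ρ' , λ N → cong get (same N)
plug-unique (setL E _) (setL E' _) r r' eq with plug-unique E E' r r' (cong sub₁ eq)
... | ρ≡ρ' , same = ρ≡ρ' , λ N → cong₂ set (same N) (cong sub₂ eq)
plug-unique (setR _ _ E) (setR _ _ E') r r' eq with plug-unique E E' r r' (cong sub₂ eq)
... | ρ≡ρ' , same = ρ≡ρ' , λ N → cong₂ set (cong sub₁ eq) (same N)
plug-unique (appL E _) (appR _ v' _) r _ eq = ⊥-elim (plug-redex-not-value E r (Eq.subst Value (sym (cong sub₁ eq)) v'))
plug-unique (appR _ v _) (appL E' _) _ r' eq = ⊥-elim (plug-redex-not-value E' r' (Eq.subst Value (cong sub₁ eq) v))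
plug-unique (setL E _) (setR _ v' _) r _ eq = ⊥-elim (plug-redex-not-value E r (Eq.subst Value (sym (cong sub₁ eq)) v'))
plug-unique (setR _ v _) (setL E' _) _ r' eq = ⊥-elim (plug-redex-not-value E' r' (Eq.subst Value (cong sub₁ eq) v))
plug-unique (appL _ _)   (getE _)     _ _ ()
plug-unique (appL _ _)   (setL _ _)   _ _ ()
plug-unique (appL _ _)   (setR _ _ _) _ _ ()
plug-unique (appR _ _ _) (getE _)     _ _ ()
plug-unique (appR _ _ _) (setL _ _)   _ _ ()
plug-unique (appR _ _ _) (setR _ _ _) _ _ ()
plug-unique (getE _)     (appL _ _)   _ _ ()
plug-unique (getE _)     (appR _ _ _) _ _ ()
plug-unique (getE _)     (setL _ _)   _ _ ()
plug-unique (getE _)     (setR _ _ _) _ _ ()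
plug-unique (setL _ _)   (appL _ _)   _ _ ()
plug-unique (setL _ _)   (appR _ _ _) _ _ ()
plug-unique (setL _ _)   (getE _)     _ _ ()
plug-unique (setR _ _ _) (appL _ _)   _ _ ()
plug-unique (setR _ _ _) (appR _ _ _) _ _ ()
plug-unique (setR _ _ _) (getE _)     _ _ ()

value-or-redex : ∀ {R M A e} → R ︔ [] ⊢ M ∶ A , e →
  Value M ⊎ Σ ECtx λ E → Σ Tm λ ρ → Redex ρ × M ≡ plug E ρ
value-or-redex (t-var _ ())
value-or-redex (t-reg _ _) = inj₁ reg
value-or-redex (t-unit _)  = inj₁ ⋆
value-or-redex (t-lam _)   = inj₁ lam
value-or-redex (t-sub ⊢M _) = value-or-redex ⊢M
value-or-redex (t-app {N = N} ⊢M ⊢N) with value-or-redex ⊢M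
... | inj₂ (E , ρ , r , refl) = inj₂ (appL E N , ρ , r , refl)
... | inj₁ v with canonical v ⊢M
...   | M₀ , refl with value-or-redex ⊢N
...     | inj₂ (E , ρ , r , refl) = inj₂ (appR (lam M₀) lam E , ρ , r , refl)
...     | inj₁ w = inj₂ (hole , _ , β-redex w , refl)
value-or-redex (t-get ⊢M) with value-or-redex ⊢M
... | inj₂ (E , ρ , r , refl) = inj₂ (getE E , ρ , r , refl)
... | inj₁ v with canonical v ⊢M
...   | refl = inj₂ (hole , _ , get-redex , refl)
value-or-redex (t-set {N = N} ⊢M ⊢N) with value-or-redex ⊢M
... | inj₂ (E , ρ , r , refl) = inj₂ (setL E N , ρ , r , refl)
... | inj₁ v with canonical v ⊢M
...   | refl with value-or-redex ⊢N
...     | inj₂ (E , ρ , r , refl) = inj₂ (setR (reg _) reg E , ρ , r , refl)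
...     | inj₁ w = inj₂ (hole , _ , set-redex w , refl)

Normal : StorePred → Config → Set
Normal P c = ∀ c' → ¬ Step P c c'

value-normal : ∀ {P V L} → Value V → Normal P (V , L)
value-normal v _ (β {E} w)     = plug-redex-not-value E (β-redex w) v
value-normal v _ (get-r {E} _) = plug-redex-not-value E get-redex v
value-normal v _ (set-r {E} w) = plug-redex-not-value E (set-redex w) v

blocked-normal : ∀ {P M L r} E → M ≡ plug E (get (reg r)) → (∀ V → ¬ Contents P L r V) → Normal P (M , L)
blocked-normal E eq none _ (β {E'} v) with plug-unique E' E (β-redex v) get-redex eq
... | () , _
blocked-normal E eq none _ (get-r {E'} {V = V} found) with plug-unique E' E get-redex get-redex eq
... | refl , _ = none V found
blocked-normal E eq none _ (set-r {E'} v) with plug-unique E' E (set-redex v) get-redex eq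
... | () , _

β-step-inversion : ∀ {P M L N V c} → Value V → M ≡ app (lam N) V → Step P (M , L) c → c ≡ (N [ V ] , L)
β-step-inversion {L = L} v eq (β {E} w) with plug-unique E hole (β-redex w) (β-redex v) eq
... | refl , same = cong (_, L) (same _)
β-step-inversion v eq (get-r {E} _) with plug-unique E hole get-redex (β-redex v) eq
... | () , _
β-step-inversion v eq (set-r {E} w) with plug-unique E hole (set-redex w) (β-redex v) eq
... | () , _

DecStore : StorePred → Set
DecStore P = ∀ r L → (Σ Tm λ V → Contents P L r V) ⊎ (∀ V → ¬ Contents P L r V)

data Progress (P : StorePred) (M : Tm) (L : Bindings) (e : Effect) : Set where
  value   : Value M → Progress P M L e
  step    : ∀ {c} → Step P (M , L) c → Progress P M L e
  blocked : ∀ E r → M ≡ plug E (get (reg r)) → r ∈ e → (∀ V → ¬ Contents P L r V) → Progress P M L e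

progress : ∀ {R P M L A e} → DecStore P → R ︔ [] ⊢ M ∶ A , e → Progress P M L e
progress {L = L} lookup ⊢M with value-or-redex ⊢M
... | inj₁ v = value v
... | inj₂ (E , _ , β-redex v , refl) = step (β {E = E} v)
... | inj₂ (E , _ , set-redex v , refl) = step (set-r {E = E} v)
... | inj₂ (E , get (reg r) , get-redex , refl) with lookup r L
...   | inj₁ (_ , found) = step (get-r {E = E} found)
...   | inj₂ none = blocked E r refl (read-in-effect E ⊢M) none

-- Simulations between reduction relations.

Simulation : StorePred → StorePred → (Config → Config → Set) → Set
Simulation P Q _~_ = ∀ {c₁ c₁' c₂} → c₁ ~ c₂ → Step P c₁ c₁' →
  Σ Config λ c₂' → Step Q c₂ c₂' × c₁' ~ c₂'

module _ {P Q : StorePred} {_~_ : Config → Config → Set} (sim : Simulation P Q _~_) where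

  sn-sim : ∀ {c₁ c₂} → c₁ ~ c₂ → SN Q c₂ → SN P c₁
  sn-sim c₁~c₂ (acc rs) = acc λ st → let (_ , st' , rel) = sim c₁~c₂ st in sn-sim rel (rs st')

  star-sim : ∀ {c₁ c₁' c₂} → c₁ ~ c₂ → Star (Step P) c₁ c₁' →
    Σ Config λ c₂' → Star (Step Q) c₂ c₂' × c₁' ~ c₂'
  star-sim c₁~c₂ done = _ , done , c₁~c₂
  star-sim c₁~c₂ (st ◅ sts) with sim c₁~c₂ st
  ... | _ , st' , rel with star-sim rel sts
  ...   | c₂' , sts' , rel' = c₂' , st' ◅ sts' , rel'

  normal-sim : ∀ {c₁ c₂} → c₁ ~ c₂ → Normal Q c₂ → Normal P c₁
  normal-sim c₁~c₂ nf _ st = nf _ (proj₁ (proj₂ (sim c₁~c₂ st)))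

step-mono : ∀ {P Q c c'} → (∀ r V → P r V → Q r V) → Step P c c' → Step Q c c'
step-mono P⊆Q (β v)              = β v
step-mono P⊆Q (get-r (inj₁ inP)) = get-r (inj₁ (P⊆Q _ _ inP))
step-mono P⊆Q (get-r (inj₂ inL)) = get-r (inj₂ inL)
step-mono P⊆Q (set-r v)          = set-r v

SameStore : StorePred → Bindings → Bindings → Set
SameStore P L₁ L₂ = ∀ r V → Contents P L₁ r V ⇔ Contents P L₂ r V

same-sym : ∀ {P L₁ L₂} → SameStore P L₁ L₂ → SameStore P L₂ L₁
same-sym same r V = mk⇔ (Equivalence.from (same r V)) (Equivalence.to (same r V))

same-cons : ∀ {P L₁ L₂ b} → SameStore P L₁ L₂ → SameStore P (b ∷ L₁) (b ∷ L₂)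
same-cons {P} {L₁} {L₂} {b} same r V = mk⇔ (extend (Equivalence.to (same r V))) (extend (Equivalence.from (same r V)))
  where
  extend : ∀ {L L'} → (Contents P L r V → Contents P L' r V) → Contents P (b ∷ L) r V → Contents P (b ∷ L') r V
  extend f (inj₁ inP)         = inj₁ inP
  extend f (inj₂ (here eq))   = inj₂ (here eq)
  extend f (inj₂ (there inL)) = [ inj₁ , (λ m → inj₂ (there m)) ]′ (f (inj₂ inL))

_≈⟨_⟩_ : Config → StorePred → Config → Set
c₁ ≈⟨ P ⟩ c₂ = proj₁ c₁ ≡ proj₁ c₂ × SameStore P (proj₂ c₁) (proj₂ c₂)

≈-simulation : ∀ {P} → Simulation P P (_≈⟨ P ⟩_)
≈-simulation (refl , same) (β v)        = _ , β v , refl , same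
≈-simulation (refl , same) (get-r found) = _ , get-r (Equivalence.to (same _ _) found) , refl , same
≈-simulation (refl , same) (set-r v)    = _ , set-r v , refl , same-cons same

eval-≈ : ∀ {P c₁ c₂ N L} → c₁ ≈⟨ P ⟩ c₂ → Eval P c₁ (N , L) →
  Σ Bindings λ L₂ → Eval P c₂ (N , L₂) × SameStore P L L₂
eval-≈ rel (sts , nf) with star-sim ≈-simulation rel sts
... | (_ , L₂) , sts' , (refl , same) = L₂ , (sts' , normal-sim ≈-simulation (refl , same-sym same) nf) , same

storeEq-intro : ∀ {P L} → (∀ r V → (r , V) ∈ L → P r V) → StoreEq P L
storeEq-intro inP r V = mk⇔ [ (λ p → p) , inP r V ]′ inj₁

storeEq-elim : ∀ {P L r V} → StoreEq P L → (r , V) ∈ L → P r V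
storeEq-elim {r = r} {V} eq inL = Equivalence.to (eq r V) (inj₂ inL)

storeEq-[] : ∀ {P} → StoreEq P []
storeEq-[] = storeEq-intro λ _ _ ()

storeEq-mono : ∀ {P Q L} → (∀ r V → P r V → Q r V) → StoreEq P L → StoreEq Q L
storeEq-mono P⊆Q eq = storeEq-intro λ r V inL → P⊆Q r V (storeEq-elim eq inL)

storeEq⇒same : ∀ {P L} → StoreEq P L → SameStore P L []
storeEq⇒same eq r V = mk⇔ (λ c → inj₁ (Equivalence.to (eq r V) c)) [ inj₁ , (λ ()) ]′

same⇒storeEq : ∀ {P L₁ L₂} → SameStore P L₁ L₂ → StoreEq P L₂ → StoreEq P L₁
same⇒storeEq same eq = storeEq-intro λ r V inL → Equivalence.to (eq r V) (Equivalence.to (same r V) (inj₂ inL))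

bindings-grow : ∀ {P c c' b} → Star (Step P) c c' → b ∈ proj₂ c → b ∈ proj₂ c'
bindings-grow done            m = m
bindings-grow (β _ ◅ sts)     m = bindings-grow sts m
bindings-grow (get-r _ ◅ sts) m = bindings-grow sts m
bindings-grow (set-r _ ◅ sts) m = bindings-grow sts (there m)

normalise : ∀ {R P M L A e} → ⊢ctx R → TypedStore R P → DecStore P →
  SN P (M , L) → R ︔ [] ⊢ M ∶ A , e → TypedBindings R L →
  Σ Config λ c → Star (Step P) (M , L) c × Normal P c
normalise ⊢R ⊢P lookup (acc rs) ⊢M ⊢L with progress lookup ⊢M
... | value v              = _ , done , value-normal v
... | blocked E _ eq _ none = _ , done , blocked-normal E eq none
... | step st with subject-reduction ⊢R ⊢P st ⊢M ⊢L
...   | ⊢M' , ⊢L' , _ with normalise ⊢R ⊢P lookup (rs st) ⊢M' ⊢L'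
...     | c , sts , nf = c , st ◅ sts , nf

-- The interpretation: basic structure.

GoodRuns : RCtx → Ty → RCtx → Tm → Set
GoodRuns R A R'' M = ∀ N L → Eval (⟦ R ⟧ˢ R'') (M , []) (N , L) → StoreEq (⟦ R ⟧ˢ R'') L × Cond A R R'' N

interp⇒≥ : ∀ {R A e R' M} → Interp R A e R' M → R' ≥ R
interp⇒≥ (ge , _ , _ , _) = ge

interp⇒typed : ∀ {R A e R' M} → Interp R A e R' M → R' ︔ [] ⊢ M ∶ A , e
interp⇒typed (_ , ⊢M , _ , _) = ⊢M

interp⇒sn : ∀ {R A e R' M} → Interp R A e R' M → ∀ R'' → R'' ≥ R' → SN (⟦ R ⟧ˢ R'') (M , [])
interp⇒sn (_ , _ , sn , _) = sn

interp⇒eval : ∀ {R A e R' M} → Interp R A e R' M → ∀ R'' → R'' ≥ R' → GoodRuns R A R'' M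
interp⇒eval (_ , _ , _ , ev) = ev

interp-≥ : ∀ {R A e R' R'' M} → Interp R A e R' M → R'' ≥ R' → Interp R A e R'' M
interp-≥ (ge , ⊢M , sn , ev) g =
  ≥-trans g ge , typing-≥ g ⊢M , (λ R₃ g₃ → sn R₃ (≥-trans g₃ g)) , λ R₃ g₃ → ev R₃ (≥-trans g₃ g)

store-dom : ∀ R {R'' r V} → ⟦ R ⟧ˢ R'' r V → r ∈ dom R
store-dom (R ▸ s ∶ A) (inj₁ (refl , _)) = ∈-++⁺ʳ (dom R) (here refl)
store-dom (R ▸ s ∶ A) (inj₂ inR)        = ∈-++⁺ˡ (store-dom R inR)

store-typed : ∀ R R'' → R'' ≥ R → TypedStore R'' (⟦ R ⟧ˢ R'')
store-typed (R ▸ s ∶ A) R'' g r V (inj₁ (refl , _ , I)) B p =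
  Eq.subst (λ T → R'' ︔ [] ⊢ V ∶ T , []) (∈ᴿ-unique (proj₁ g) (∈ᴿ-≥ g here) p) (interp⇒typed I)
store-typed (R ▸ s ∶ A) R'' g r V (inj₂ inR) = store-typed R R'' (≥-unsnoc g) r V inR

store-≥ : ∀ R {R'' R₃ r V} → R₃ ≥ R'' → ⟦ R ⟧ˢ R'' r V → ⟦ R ⟧ˢ R₃ r V
store-≥ (R ▸ s ∶ A) g (inj₁ (eq , v , I)) = inj₁ (eq , v , interp-≥ I g)
store-≥ (R ▸ s ∶ A) g (inj₂ inR)          = inj₂ (store-≥ R g inR)

store-extend : ∀ R X {R'' r V} → ⟦ R ⟧ˢ R'' r V → ⟦ R ⧺ X ⟧ˢ R'' r V
store-extend R ε           inR = inR
store-extend R (X ▸ _ ∶ _) inR = inj₂ (store-extend R X inR)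

store-restrict : ∀ R X {R'' r V} → ⊢ctx (R ⧺ X) → r ∈ dom R → ⟦ R ⧺ X ⟧ˢ R'' r V → ⟦ R ⟧ˢ R'' r V
store-restrict R ε           _              _   inR               = inR
store-restrict R (X ▸ _ ∶ _) (wf-ext _ s∉) r∈R (inj₁ (refl , _)) = ⊥-elim (s∉ (dom-⧺ X r∈R))
store-restrict R (X ▸ _ ∶ _) (wf-ext ⊢A _) r∈R (inj₂ inRX)       = store-restrict R X (wfTy⇒wfCtx ⊢A) r∈R inRX

ReductsIn : RCtx → Ty → Effect → RCtx → Tm → Set
ReductsIn R A e R' M = ∀ R'' → R'' ≥ R' → ∀ M' L → Step (⟦ R ⟧ˢ R'') (M , []) (M' , L) →
  Interp R A e R'' M' × StoreEq (⟦ R ⟧ˢ R'') L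

expansion : ∀ R A e R' M → R' ≥ R → R' ︔ [] ⊢ M ∶ A , e → ReductsIn R A e R' M →
  (∀ R'' → R'' ≥ R' → Normal (⟦ R ⟧ˢ R'') (M , []) → Cond A R R'' M) →
  Interp R A e R' M
expansion R A e R' M ge ⊢M reducts normal-cond = ge , ⊢M , sn , ev
  where
  sn : ∀ R'' → R'' ≥ R' → SN (⟦ R ⟧ˢ R'') (M , [])
  sn R'' g = acc λ {c} st → let (I , eq) = reducts R'' g (proj₁ c) (proj₂ c) st in
    sn-sim ≈-simulation (refl , storeEq⇒same eq) (interp⇒sn I R'' (≥-refl (proj₁ g)))
  ev : ∀ R'' → R'' ≥ R' → GoodRuns R A R'' M
  ev R'' g N L (done , nf) = storeEq-[] , normal-cond R'' g nf
  ev R'' g N L (st ◅ sts , nf) with reducts R'' g _ _ st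
  ... | I , eq with eval-≈ (refl , storeEq⇒same eq) (sts , nf)
  ...   | L₂ , eval₂ , same with interp⇒eval I R'' (≥-refl (proj₁ g)) N L₂ eval₂
  ...     | eq₂ , cond = same⇒storeEq same eq₂ , cond

-- Canonical inhabitants and non-emptiness.

witness : Ty → Tm
witness 𝟙            = ⋆
witness (Reg r _)    = reg r
witness (_ ⇒[ _ ] B) = lam (witness B)

witness-value : ∀ A → Value (witness A)
witness-value 𝟙            = ⋆
witness-value (Reg _ _)    = reg
witness-value (_ ⇒[ _ ] _) = lam

witness-closed : ∀ A σ → subst σ (witness A) ≡ witness A
witness-closed 𝟙            σ = refl
witness-closed (Reg _ _)    σ = refl
witness-closed (_ ⇒[ _ ] B) σ = cong lam (witness-closed B (exts σ))

witness-typing : ∀ {R Γ A} → R ⊢ty A → WfΓ R Γ → R ︔ Γ ⊢ witness A ∶ A , []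
witness-typing (wf-𝟙 _)          w = t-unit w
witness-typing (wf-reg _ p)      w = t-reg w p
witness-typing (wf-arr ⊢A ⊢B e⊆) w =
  t-lam (t-sub (witness-typing ⊢B (proj₁ w , ⊢A ∷ proj₂ w)) (≤-refl ⊢B , (λ ()) , e⊆))

value-star : ∀ {P V c} → Value V → Star (Step P) (V , []) c → c ≡ (V , [])
value-star v done      = refl
value-star v (st ◅ _)  = ⊥-elim (value-normal v _ st)

witness-interp : ∀ R A → R ⊢ty A → ∀ R' → R' ≥ R → ∀ e → e ⊆ dom R → Interp R A e R' (witness A)
witness-cond : ∀ {R} A → R ⊢ty A → ∀ R'' → R'' ≥ R → Cond A R R'' (witness A)

witness-interp R A ⊢A R' ge e e⊆ = ge , ⊢witness , sn , ev
  where
  ⊢witness : R' ︔ [] ⊢ witness A ∶ A , e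
  ⊢witness = t-sub (witness-typing (wfTy-≥ ge ⊢A) (proj₁ ge , []))
                   (≤-refl (wfTy-≥ ge ⊢A) , (λ ()) , ⊆-trans e⊆ (dom-≥ ge))
  sn : ∀ R'' → R'' ≥ R' → SN (⟦ R ⟧ˢ R'') (witness A , [])
  sn _ _ = acc λ st → ⊥-elim (value-normal (witness-value A) _ st)
  ev : ∀ R'' → R'' ≥ R' → GoodRuns R A R'' (witness A)
  ev R'' g N L (sts , _) with value-star (witness-value A) sts
  ... | refl = storeEq-[] , witness-cond A ⊢A R'' (≥-trans g ge)

witness-cond 𝟙         _ _ _ = refl
witness-cond (Reg _ _) _ _ _ = refl
witness-cond {R} (A₁ ⇒[ e₁ ] A₂) (wf-arr ⊢A₁ ⊢A₂ e₁⊆) R'' g = (witness A₂ , refl) , applied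
  where
  -- (λ. witness A₂) V steps only to witness A₂, which is interpreted.
  applied : ∀ R₁ → R₁ ≥ R'' → ∀ V → Value V → Interp R A₁ [] R₁ V →
            Interp R A₂ e₁ R₁ (app (lam (witness A₂)) V)
  applied R₁ g₁ V v I = expansion R A₂ e₁ R₁ _ g₁R ⊢app reducts
      (λ _ _ nf → ⊥-elim (nf _ (β {E = hole} v)))
    where
    g₁R : R₁ ≥ R
    g₁R = ≥-trans g₁ g
    ⊢λ : R₁ ︔ [] ⊢ lam (witness A₂) ∶ A₁ ⇒[ e₁ ] A₂ , []
    ⊢λ = witness-typing (wfTy-≥ g₁R (wf-arr ⊢A₁ ⊢A₂ e₁⊆)) (proj₁ g₁R , [])
    ⊢app : R₁ ︔ [] ⊢ app (lam (witness A₂)) V ∶ A₂ , e₁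
    ⊢app = t-sub (t-app ⊢λ (interp⇒typed I))
                 (≤-refl (wfTy-≥ g₁R ⊢A₂) , ⊆-reflexive (++-identityʳ e₁) , ⊆-trans e₁⊆ (dom-≥ g₁R))
    reducts : ReductsIn R A₂ e₁ R₁ (app (lam (witness A₂)) V)
    reducts R₂ g₂ M' L st with β-step-inversion v refl st
    ... | refl = Eq.subst (Interp R A₂ e₁ R₂) (sym (witness-closed A₂ _))
                   (witness-interp R A₂ ⊢A₂ R₂ (≥-trans g₂ g₁R) e₁ e₁⊆) , storeEq-[]

bindings-lookup : ∀ r (L : Bindings) → (Σ Tm λ V → (r , V) ∈ L) ⊎ (∀ V → ¬ (r , V) ∈ L)
bindings-lookup r [] = inj₂ λ _ ()
bindings-lookup r ((s , W) ∷ L) with s ≟ℕ r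
... | yes refl = inj₁ (W , here refl)
... | no s≢r with bindings-lookup r L
...   | inj₁ (V , inL) = inj₁ (V , there inL)
...   | inj₂ none = inj₂ λ { V (here eq) → s≢r (sym (cong proj₁ eq)) ; V (there inL) → none V inL }

-- The store ⟦ R ⟧(R'') holds a value in every region of R (by the witnesses),
store-inhabited : ∀ R → ⊢ctx R → ∀ {r} → r ∈ dom R → ∀ R'' → R'' ≥ R → Σ Tm λ V → ⟦ R ⟧ˢ R'' r V
store-inhabited ε _ () _ _
store-inhabited (R ▸ s ∶ A) (wf-ext ⊢A _) r∈ R'' g with ∈-++⁻ (dom R) r∈
... | inj₁ r∈R = let (V , inR) = store-inhabited R (wfTy⇒wfCtx ⊢A) r∈R R'' (≥-unsnoc g) in V , inj₂ inR
... | inj₂ (here refl) =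
  witness A , inj₁ (refl , witness-value A , witness-interp R A ⊢A R'' (≥-unsnoc g) [] (λ ()))

-- so lookups in it are decidable: regions of R are inhabited, the others
-- can only be bound by the finitely many added bindings.
store-decidable : ∀ R R'' → R'' ≥ R → DecStore (⟦ R ⟧ˢ R'')
store-decidable R R'' g r L with r ∈? dom R
... | yes r∈R = let (V , inR) = store-inhabited R (≥⇒wfCtx g) r∈R R'' g in inj₁ (V , inj₁ inR)
... | no r∉R with bindings-lookup r L
...   | inj₁ (V , inL) = inj₁ (V , inj₂ inL)
...   | inj₂ none      = inj₂ λ V → [ (λ inR → r∉R (store-dom R inR)) , none V ]′

-- Reduction closure.

-- A step of an interpreted program leaves the store unchanged: a value
-- written by the step survives to the end of the (terminating) run, and
-- the final store is ⟦ R ⟧(R').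
reduct-store : ∀ {R A e R' M M' L} → Interp R A e R' M → Step (⟦ R ⟧ˢ R') (M , []) (M' , L) →
  StoreEq (⟦ R ⟧ˢ R') L
reduct-store I (β _)     = storeEq-[]
reduct-store I (get-r _) = storeEq-[]
reduct-store {R} {R' = R'} I st@(set-r {r = r} {V = V} _) =
  storeEq-intro λ { _ _ (here refl) → written ; _ _ (there ()) }
  where
  ⊢R' : ⊢ctx R'
  ⊢R' = proj₁ (interp⇒≥ I)
  ⊢store : TypedStore R' (⟦ R ⟧ˢ R')
  ⊢store = store-typed R R' (interp⇒≥ I)
  written : ⟦ R ⟧ˢ R' r V
  written with interp⇒sn I R' (≥-refl ⊢R')
  ... | acc rs with subject-reduction ⊢R' ⊢store st (interp⇒typed I) (λ _ _ ())
  ...   | ⊢M' , ⊢L , _ with normalise ⊢R' ⊢store (store-decidable R R' (interp⇒≥ I)) (rs st) ⊢M' ⊢L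
  ...     | (N , L') , sts , nf =
    storeEq-elim (proj₁ (interp⇒eval I R' (≥-refl ⊢R') N L' (st ◅ sts , nf))) (bindings-grow sts (here refl))

-- Reduction closure in the world of the program; other worlds follow by weakening.
reduction-closure : ∀ {R A e R' M M' L} → Interp R A e R' M → Step (⟦ R ⟧ˢ R') (M , []) (M' , L) →
  Interp R A e R' M' × StoreEq (⟦ R ⟧ˢ R') L
reduction-closure {R} {A} {e} {R'} {M} {M'} {L} I st = (interp⇒≥ I , ⊢M' , sn , ev) , unchanged
  where
  unchanged : StoreEq (⟦ R ⟧ˢ R') L
  unchanged = reduct-store I st
  ⊢M' : R' ︔ [] ⊢ M' ∶ A , e
  ⊢M' = proj₁ (subject-reduction (proj₁ (interp⇒≥ I)) (store-typed R R' (interp⇒≥ I)) st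
                                  (interp⇒typed I) (λ _ _ ()))
  step₃ : ∀ R₃ → R₃ ≥ R' → Step (⟦ R ⟧ˢ R₃) (M , []) (M' , L)
  step₃ R₃ g₃ = step-mono (λ _ _ → store-≥ R g₃) st
  same₃ : ∀ R₃ → R₃ ≥ R' → (M' , []) ≈⟨ ⟦ R ⟧ˢ R₃ ⟩ (M' , L)
  same₃ R₃ g₃ = refl , same-sym (storeEq⇒same (storeEq-mono (λ _ _ → store-≥ R g₃) unchanged))
  sn : ∀ R₃ → R₃ ≥ R' → SN (⟦ R ⟧ˢ R₃) (M' , [])
  sn R₃ g₃ with interp⇒sn I R₃ g₃
  ... | acc rs = sn-sim ≈-simulation (same₃ R₃ g₃) (rs (step₃ R₃ g₃))
  ev : ∀ R₃ → R₃ ≥ R' → GoodRuns R A R₃ M'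
  ev R₃ g₃ N L₁ eval with eval-≈ (same₃ R₃ g₃) eval
  ... | L₂ , (sts , nf) , same with interp⇒eval I R₃ g₃ N L₂ (step₃ R₃ g₃ ◅ sts , nf)
  ...   | eq , cond = same⇒storeEq same eq , cond

-- Expansion closure.

-- A normal, neutral, typed program reading only regions of R satisfies 𝒞:
-- the store ⟦ R ⟧(R'') cannot block it, so it is a value, and being
-- neutral it is not a λ-abstraction.
normal-cond : ∀ R A e R'' M → e ⊆ dom R → R'' ≥ R → R'' ︔ [] ⊢ M ∶ A , e → Neutral M →
  Normal (⟦ R ⟧ˢ R'') (M , []) → Cond A R R'' M
normal-cond R A e R'' M e⊆ g ⊢M neutral nf with progress (store-decidable R R'' g) ⊢M
... | step st = ⊥-elim (nf _ st)
... | blocked _ _ _ r∈e none =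
  let (V , inR) = store-inhabited R (≥⇒wfCtx g) (e⊆ r∈e) R'' g in ⊥-elim (none V (inj₁ inR))
... | value v = shape-cond A (canonical v ⊢M)
  where
  shape-cond : ∀ B → Shape B M → Cond B R R'' M
  shape-cond 𝟙            s        = s
  shape-cond (Reg _ _)    s        = s
  shape-cond (_ ⇒[ _ ] _) (N , eq) = ⊥-elim (neutral N eq)

expansion-closure : ExpansionClosure
expansion-closure R A e R' M (_ , e⊆) ge ⊢M neutral reducts =
  expansion R A e R' M ge ⊢M reducts λ R'' g nf →
    normal-cond R A e R'' M e⊆ (≥-trans g ge) (typing-≥ g ⊢M) neutral nf

-- Semantic subtyping.

interp-≤ : ∀ {R A A'} → R ⊢ A ≤ A' → ∀ {e e'} → e ⊆ e' → e' ⊆ dom R →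
  ∀ R' M → Interp R A e R' M → Interp R A' e' R' M
cond-≤ : ∀ {R A A' R'' N} → R ⊢ A ≤ A' → Cond A R R'' N → Cond A' R R'' N

interp-≤ A≤A' e⊆e' e'⊆ R' M (ge , ⊢M , sn , ev) =
  ge , t-sub ⊢M (≤-≥ ge A≤A' , e⊆e' , ⊆-trans e'⊆ (dom-≥ ge)) , sn ,
  λ R'' g N L eval → let (eq , cond) = ev R'' g N L eval in eq , cond-≤ A≤A' cond

cond-≤ (≤-refl _) cond = cond
cond-≤ (≤-arr A'≤A B≤B' e⊆e' e'⊆) (isλ , applied) = isλ , λ R₁ g₁ V v I →
  interp-≤ B≤B' e⊆e' e'⊆ R₁ _ (applied R₁ g₁ V v (interp-≤ A'≤A (λ ()) (λ ()) R₁ V I))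

-- Extension and restriction.

_⊆[_]_ : StorePred → List Region → StorePred → Set
X ⊆[ D ] Y = ∀ r V → r ∈ D → X r V → Y r V

Confined : RCtx → List Region → Config → Set
Confined R D c = Σ Ty λ A → Σ Effect λ e →
  R ︔ [] ⊢ proj₁ c ∶ A , e × e ⊆ D × TypedBindings R (proj₂ c) × (∀ r V → (r , V) ∈ proj₂ c → r ∈ D)

confined-step : ∀ {R D X c c'} → ⊢ctx R → TypedStore R X → Step X c c' → Confined R D c → Confined R D c'
confined-step ⊢R ⊢X st (A , e , ⊢M , e⊆ , ⊢L , L⊆) with subject-reduction ⊢R ⊢X st ⊢M ⊢L
... | ⊢M' , ⊢L' , new = A , e , ⊢M' , e⊆ , ⊢L' , λ r V m → [ L⊆ r V , e⊆ ]′ (new r V m)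

-- A confined program only reads regions in D, so a store containing X on D allows the same step.
step-agree : ∀ {R D X Y c c'} → X ⊆[ D ] Y → Step X c c' → Confined R D c → Step Y c c'
step-agree X⊆Y (β v)                  _                     = β v
step-agree X⊆Y (set-r v)              _                     = set-r v
step-agree X⊆Y (get-r (inj₂ inL))     _                     = get-r (inj₂ inL)
step-agree X⊆Y (get-r {E} (inj₁ inX)) (_ , _ , ⊢M , e⊆ , _) =
  get-r (inj₁ (X⊆Y _ _ (e⊆ (read-in-effect E ⊢M)) inX))

agree-simulation : ∀ {R D X Y} → ⊢ctx R → TypedStore R X → X ⊆[ D ] Y →
  Simulation X Y (λ c₁ c₂ → c₁ ≡ c₂ × Confined R D c₁)
agree-simulation ⊢R ⊢X X⊆Y (refl , conf) st = _ , step-agree X⊆Y st conf , refl , confined-step ⊢R ⊢X st conf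

storeEq-agree : ∀ {R D X Y c} → X ⊆[ D ] Y → Confined R D c → StoreEq X (proj₂ c) → StoreEq Y (proj₂ c)
storeEq-agree X⊆Y (_ , _ , _ , _ , _ , L⊆) eq =
  storeEq-intro λ r V inL → X⊆Y r V (L⊆ r V inL) (storeEq-elim eq inL)

interp-transport : ∀ Ra Rb A e R'' M D → e ⊆ D →
  (∀ R₃ → R₃ ≥ R'' → TypedStore R₃ (⟦ Ra ⟧ˢ R₃) × TypedStore R₃ (⟦ Rb ⟧ˢ R₃) ×
                      ⟦ Ra ⟧ˢ R₃ ⊆[ D ] ⟦ Rb ⟧ˢ R₃ × ⟦ Rb ⟧ˢ R₃ ⊆[ D ] ⟦ Ra ⟧ˢ R₃) →
  (∀ R₃ → R₃ ≥ R'' → ∀ N → Cond A Ra R₃ N → Cond A Rb R₃ N) →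
  R'' ≥ Rb → Interp Ra A e R'' M → Interp Rb A e R'' M
interp-transport Ra Rb A e R'' M D e⊆ stores cond gb (_ , ⊢M , sn , ev) = gb , ⊢M , sn' , ev'
  where
  start : ∀ R₃ → R₃ ≥ R'' → Confined R₃ D (M , [])
  start R₃ g₃ = A , e , typing-≥ g₃ ⊢M , e⊆ , (λ _ _ ()) , λ _ _ ()
  sn' : ∀ R₃ → R₃ ≥ R'' → SN (⟦ Rb ⟧ˢ R₃) (M , [])
  sn' R₃ g₃ with stores R₃ g₃
  ... | _ , ⊢b , _ , b⊆a = sn-sim (agree-simulation (proj₁ g₃) ⊢b b⊆a) (refl , start R₃ g₃) (sn R₃ g₃)
  ev' : ∀ R₃ → R₃ ≥ R'' → GoodRuns Rb A R₃ M
  ev' R₃ g₃ N L (sts , nf) with stores R₃ g₃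
  ... | ⊢a , ⊢b , a⊆b , b⊆a with star-sim (agree-simulation (proj₁ g₃) ⊢b b⊆a) (refl , start R₃ g₃) sts
  ...   | _ , sts' , (refl , conf)
    with ev R₃ g₃ N L (sts' , normal-sim (agree-simulation (proj₁ g₃) ⊢a a⊆b) (refl , conf) nf)
  ...     | eq , c = storeEq-agree a⊆b conf eq , cond R₃ g₃ N c

-- ⟦ R ⊢ (A , e) ⟧ and ⟦ R ⧺ X ⊢ (A , e) ⟧ coincide in worlds extending R ⧺ X,
-- since ⟦ R ⟧ and ⟦ R ⧺ X ⟧ agree on dom R; by induction on A, the same holds for 𝒞.
interp-extend : ∀ R X A → R ⊢ty A → ∀ e → e ⊆ dom R → ⊢ctx (R ⧺ X) →
  ∀ R'' → R'' ≥ (R ⧺ X) → ∀ M → Interp R A e R'' M ⇔ Interp (R ⧺ X) A e R'' M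
cond-extend : ∀ R X A → R ⊢ty A → ⊢ctx (R ⧺ X) →
  ∀ R₃ → R₃ ≥ (R ⧺ X) → ∀ N → Cond A R R₃ N ⇔ Cond A (R ⧺ X) R₃ N

interp-extend R X A ⊢A e e⊆ ⊢RX R'' g M = mk⇔
  (interp-transport R (R ⧺ X) A e R'' M (dom R) e⊆ stores
     (λ R₃ g₃ N → Equivalence.to (cond-extend R X A ⊢A ⊢RX R₃ (≥-trans g₃ g) N)) g)
  (interp-transport (R ⧺ X) R A e R'' M (dom R) e⊆ stores⁻¹
     (λ R₃ g₃ N → Equivalence.from (cond-extend R X A ⊢A ⊢RX R₃ (≥-trans g₃ g) N)) (≥-trans g RX≥R))
  where
  RX≥R : (R ⧺ X) ≥ R
  RX≥R = ⊢RX , X , refl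
  stores : ∀ R₃ → R₃ ≥ R'' →
    TypedStore R₃ (⟦ R ⟧ˢ R₃) × TypedStore R₃ (⟦ R ⧺ X ⟧ˢ R₃) ×
    ⟦ R ⟧ˢ R₃ ⊆[ dom R ] ⟦ R ⧺ X ⟧ˢ R₃ × ⟦ R ⧺ X ⟧ˢ R₃ ⊆[ dom R ] ⟦ R ⟧ˢ R₃
  stores R₃ g₃ =
    store-typed R R₃ (≥-trans g₃ (≥-trans g RX≥R)) , store-typed (R ⧺ X) R₃ (≥-trans g₃ g) ,
    (λ _ _ _ → store-extend R X) , (λ _ _ r∈R → store-restrict R X ⊢RX r∈R)
  stores⁻¹ : ∀ R₃ → R₃ ≥ R'' →
    TypedStore R₃ (⟦ R ⧺ X ⟧ˢ R₃) × TypedStore R₃ (⟦ R ⟧ˢ R₃) ×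
    ⟦ R ⧺ X ⟧ˢ R₃ ⊆[ dom R ] ⟦ R ⟧ˢ R₃ × ⟦ R ⟧ˢ R₃ ⊆[ dom R ] ⟦ R ⧺ X ⟧ˢ R₃
  stores⁻¹ R₃ g₃ = let (⊢R , ⊢RX' , R⊆RX , RX⊆R) = stores R₃ g₃ in ⊢RX' , ⊢R , RX⊆R , R⊆RX

cond-extend R X 𝟙         _ _ _ _ _ = mk⇔ id id
cond-extend R X (Reg _ _) _ _ _ _ _ = mk⇔ id id
cond-extend R X (A₁ ⇒[ e₁ ] A₂) (wf-arr ⊢A₁ ⊢A₂ e₁⊆) ⊢RX R₃ g₃ N = mk⇔
  (λ { (isλ , applied) → isλ , λ R₁ g₁ V v I →
         Equivalence.to (result R₁ g₁ V) (applied R₁ g₁ V v (Equivalence.from (argument R₁ g₁ V) I)) })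
  (λ { (isλ , applied) → isλ , λ R₁ g₁ V v I →
         Equivalence.from (result R₁ g₁ V) (applied R₁ g₁ V v (Equivalence.to (argument R₁ g₁ V) I)) })
  where
  argument : ∀ R₁ → R₁ ≥ R₃ → ∀ V → Interp R A₁ [] R₁ V ⇔ Interp (R ⧺ X) A₁ [] R₁ V
  argument R₁ g₁ = interp-extend R X A₁ ⊢A₁ [] (λ ()) ⊢RX R₁ (≥-trans g₁ g₃)
  result : ∀ R₁ → R₁ ≥ R₃ → ∀ V → Interp R A₂ e₁ R₁ (app N V) ⇔ Interp (R ⧺ X) A₂ e₁ R₁ (app N V)
  result R₁ g₁ V = interp-extend R X A₂ ⊢A₂ e₁ e₁⊆ ⊢RX R₁ (≥-trans g₁ g₃) (app N V)

-- Proposition 5.  Strong normalisation is clause (2) of the definition;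
-- reduction closure is applied in the larger world R'' after weakening,
-- and non-emptiness is witnessed by the canonical inhabitant.

proposition5 : Weakening × ExtensionRestriction × SubtypingProp ×
    StrongNormalisation × ReductionClosure × NonEmptiness × ExpansionClosure
proposition5 =
  (λ R R' R'' A e M g _ _ I → interp-≥ I g) ,
  (λ { R R' R'' A e M g (⊢R' , X , refl) (⊢A , e⊆) → interp-extend R X A ⊢A e e⊆ ⊢R' R'' g M }) ,
  (λ { R A e A' e' (A≤A' , e⊆e' , e'⊆) → interp-≤ A≤A' e⊆e' e'⊆ }) ,
  (λ R A e R' R'' M I g → interp⇒sn I R'' g) ,
  (λ R A e R' R'' M M' L I g st → reduction-closure (interp-≥ I g) st) ,
  (λ R A ⊢A → witness A , witness-value A , witness-interp R A ⊢A) ,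
  expansion-closure
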